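{- The functor $j : \mathbf{CABAO} \to \mathbf{CABAOBisim}$, which is the identity on objects and sends a complete Boolean homomorphism $f^* : \mathcal{B}\to\mathcal{B}'$ preserving $\Box$ to the relation $b \mathrel{j(f^*)} b'$ iff $b \sqsubseteq f_!(b')$ (where $f_!$ is the left adjoint of $f^*$), is faithful and injective-on-objects.
   Context: A CABAO $(\mathcal{B},\Box_{\mathcal{B}})$ is a complete atomic Boolean algebra with a meet-preserving operator $\Box_{\mathcal{B}}$, whose left adjoint is written $\Diamond^{ - }_{\mathcal{B}}$ ($\Diamond^{ - }x\sqsubseteq y$ iff $x\sqsubseteq\Box y$). $\mathbf{CABAO}$: CABAOs and complete Boolean homomorphisms $f^*$ with $f^*\circ\Box_{\mathcal{B}}=\Box_{\mathcal{B}'}\circ f^*$. A relation $Q\subseteq\mathcal{B}\times\mathcal{B}'$ is directionally atomic if a bimodule ($p'\sqsubseteq p\mathrel{Q} q\sqsubseteq q'\Rightarrow p'\mathrel{Q} q'$), left-disjunctive ($a_i\mathrel{Q} b$ for all $i$ implies $\bigsqcup_i a_i\mathrel{Q} b$), atomic-founded (atom $a$, $a\mathrel{Q} b$ implies $a\mathrel{Q} b'$ for some atom $b'\sqsubseteq b$). Its variant $Q^{\circ}\subseteq\mathcal{B}'\times\mathcal{B}$: $b'\mathrel{Q^{\circ}} b$ iff every atom $a'\sqsubseteq b'$ has an atom $a\sqsubseteq b$ with $a\mathrel{Q} a'$. $Q$ is bisimulatory if directionally atomic, $A\mathrel{Q}\Box_{\mathcal{B}'}B$ implies $\Diamond^{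 - }_{\mathcal{B}}A\mathrel{Q} B$, and $B\mathrel{Q^{\circ}}\Box_{\mathcal{B}}A$ implies $\Diamond^{ - }_{\mathcal{B}'}B\mathrel{Q^{\circ}}A$. $\mathbf{CABAOBisim}$: CABAOs and bisimulatory relations, relational composition, identity $\sqsubseteq$. -}

module Defs where

open import Data.Bool using (Bool; true; false; if_then_else_)
open import Data.Empty using (⊥)
open import Data.Product using (Σ; _×_; proj₁)
open import Data.Sum using (_⊎_)
open import Relation.Nullary using (¬_)
open import Relation.Binary.PropositionalEquality using (_≡_)

-- two-element family, used to express binary meets/joins via complete ones
pair : {A : Set} → A → A → Bool → A
pair x y b = if b then x else y

record CBA : Set₁ where
  field
    Carrier   : Set
    _⊑_       : Carrier → Carrier → Set
    ⊑-refl    : ∀ {x} → x ⊑ x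
    ⊑-trans   : ∀ {x y z} → x ⊑ y → y ⊑ z → x ⊑ z
    ⊑-antisym : ∀ {x y} → x ⊑ y → y ⊑ x → x ≡ y
    ⋁         : {I : Set} → (I → Carrier) → Carrier
    ⋁-upper   : ∀ {I} (f : I → Carrier) (i : I) → f i ⊑ ⋁ f
    ⋁-least   : ∀ {I} (f : I → Carrier) (x : Carrier) → (∀ i → f i ⊑ x) → ⋁ f ⊑ x
    ⋀         : {I : Set} → (I → Carrier) → Carrier
    ⋀-lower   : ∀ {I} (f : I → Carrier) (i : I) → ⋀ f ⊑ f i
    ⋀-greatest : ∀ {I} (f : I → Carrier) (x : Carrier) → (∀ i → x ⊑ f i) → x ⊑ ⋀ f
    compl     : Carrier → Carrier
    -- x ⊓ ¬x = ⊥ and x ⊔ ¬x = ⊤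
    compl-meet : ∀ x → ⋀ (pair x (compl x)) ≡ ⋁ {⊥} (λ ())
    compl-join : ∀ x → ⋁ (pair x (compl x)) ≡ ⋀ {⊥} (λ ())
    distrib   : ∀ x y z → ⋀ (pair x (⋁ (pair y z))) ⊑ ⋁ (pair (⋀ (pair x y)) (⋀ (pair x z)))

  bot : Carrier
  bot = ⋁ {⊥} (λ ())

  top : Carrier
  top = ⋀ {⊥} (λ ())

  IsAtom : Carrier → Set
  IsAtom a = (¬ (a ≡ bot)) × (∀ y → y ⊑ a → (y ≡ bot) ⊎ (y ≡ a))

  IsAtomic : Set
  IsAtomic = ∀ x → ⋁ {Σ Carrier (λ a → IsAtom a × (a ⊑ x))} proj₁ ≡ x

record CABA : Set₁ where
  field
    cba    : CBA
    atomic : CBA.IsAtomic cba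
  open CBA cba public

record CABAO : Set₁ where
  field
    caba : CABA
  open CABA caba public
  field
    □      : Carrier → Carrier
    □-meet : ∀ {I : Set} (f : I → Carrier) → □ (⋀ f) ≡ ⋀ (λ i → □ (f i))

  -- its left adjoint ◇⁻ (◇⁻ x ⊑ y iff x ⊑ □ y), given by the standard formula
  ◇⁻ : Carrier → Carrier
  ◇⁻ x = ⋀ {Σ Carrier (λ y → x ⊑ □ y)} proj₁

open CABAO

record CABAOHom (B B' : CABAO) : Set₁ where
  field
    fun      : Carrier B → Carrier B'
    pres-⋁   : ∀ {I : Set} (f : I → Carrier B) → fun (⋁ B f) ≡ ⋁ B' (λ i → fun (f i))
    pres-⋀   : ∀ {I : Set} (f : I → Carrier B) → fun (⋀ B f) ≡ ⋀ B' (λ i → fun (f i))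
    pres-compl : ∀ x → fun (compl B x) ≡ compl B' (fun x)
    pres-□   : ∀ x → fun (□ B x) ≡ □ B' (fun x)

open CABAOHom

lowerShriek : {B B' : CABAO} → CABAOHom B B' → Carrier B' → Carrier B
lowerShriek {B} {B'} f b' = ⋀ B {Σ (Carrier B) (λ b → _⊑_ B' b' (fun f b))} proj₁

jObj : CABAO → CABAO
jObj B = B

jMor : {B B' : CABAO} → CABAOHom B B' → Carrier B → Carrier B' → Set
jMor {B} f b b' = _⊑_ B b (lowerShriek f b')

{-# OPTIONS --safe #-}
module Submission where

-- A relation b ⊑ p, read as a function of b, determines p; so j(f*) determines f_!,
-- and f_! determines f* as its right adjoint.  On objects j is the identity.

open import Defs
open import Data.Bool using (true; false)
open import Data.Product using (_×_; _,_; proj₁; proj₂)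
open import Function.Bundles using (_⇔_; mk⇔; Equivalence)
open import Function.Construct.Composition using (_⇔-∘_)
open import Function.Construct.Symmetry using (⇔-sym)
open import Relation.Binary.PropositionalEquality using (_≡_; sym; trans; cong; subst)

open CABAO using (cba)
open CABAOHom using (fun; pres-⋀)
open Equivalence using (to; from)

module _ (A : CBA) where
  open CBA A

  downsets-equal⇒≡ : ∀ {x y} → (∀ z → z ⊑ x ⇔ z ⊑ y) → x ≡ y
  downsets-equal⇒≡ {x} {y} x↓⇔y↓ =
    ⊑-antisym (to (x↓⇔y↓ x) ⊑-refl) (from (x↓⇔y↓ y) ⊑-refl)

  ⋀-pair-≡ˡ : ∀ {x y} → x ⊑ y → ⋀ (pair x y) ≡ x
  ⋀-pair-≡ˡ {x} {y} x⊑y =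
    ⊑-antisym (⋀-lower (pair x y) true)
              (⋀-greatest (pair x y) x λ { true → ⊑-refl ; false → x⊑y })

⋀-preserving⇒monotone : (A A' : CBA) (F : CBA.Carrier A → CBA.Carrier A')
  → (∀ {I : Set} (xs : I → CBA.Carrier A) → F (CBA.⋀ A xs) ≡ CBA.⋀ A' (λ i → F (xs i)))
  → ∀ {x y} → CBA._⊑_ A x y → CBA._⊑_ A' (F x) (F y)
⋀-preserving⇒monotone A A' F pres {x} {y} x⊑y =
  subst (λ z → z ⊑' F y) Fx≡ (CBA.⋀-lower A' (λ i → F (pair x y i)) false)
  where
    open CBA A' using () renaming (_⊑_ to _⊑'_)
    Fx≡ : CBA.⋀ A' (λ i → F (pair x y i)) ≡ F x
    Fx≡ = trans (sym (pres (pair x y))) (cong F (⋀-pair-≡ˡ A x⊑y))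

module _ {B B' : CABAO} (f : CABAOHom B B') where
  open CABAO B using (_⊑_; ⋀-lower; ⊑-refl)
  open CABAO B' using () renaming (_⊑_ to _⊑'_; ⋀-greatest to ⋀'-greatest; ⊑-trans to ⊑'-trans)

  lowerShriek-unit : ∀ b' → b' ⊑' fun f (lowerShriek f b')
  lowerShriek-unit b' = subst (b' ⊑'_) (sym (pres-⋀ f proj₁)) (⋀'-greatest _ b' proj₂)

  fun-monotone : ∀ {x y} → x ⊑ y → fun f x ⊑' fun f y
  fun-monotone = ⋀-preserving⇒monotone (cba B) (cba B') (fun f) (pres-⋀ f)

  lowerShriek⊣fun : ∀ {b' x} → lowerShriek f b' ⊑ x ⇔ b' ⊑' fun f x
  lowerShriek⊣fun {b'} {x} = mk⇔
    (λ f!b'⊑x → ⊑'-trans (lowerShriek-unit b') (fun-monotone f!b'⊑x))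
    (λ b'⊑fx → ⋀-lower proj₁ (x , b'⊑fx))

j-faithful : ∀ {B B' : CABAO} (f g : CABAOHom B B')
  → (∀ b b' → jMor f b b' ⇔ jMor g b b')
  → ∀ x → fun f x ≡ fun g x
j-faithful {B} {B'} f g jf⇔jg x = downsets-equal⇒≡ (cba B') λ b' →
  lowerShriek⊣fun g ⇔-∘ (subst-lower (f!≡g! b') ⇔-∘ ⇔-sym (lowerShriek⊣fun f))
  where
    open CABAO B using (_⊑_)
    f!≡g! : ∀ b' → lowerShriek f b' ≡ lowerShriek g b'
    f!≡g! b' = downsets-equal⇒≡ (cba B) (λ b → jf⇔jg b b')
    subst-lower : ∀ {p q} → p ≡ q → p ⊑ x ⇔ q ⊑ x
    subst-lower p≡q = mk⇔ (subst (_⊑ x) p≡q) (subst (_⊑ x) (sym p≡q))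

mainTheorem19 :
    -- faithful: j(f*) = j(g*) (as relations) implies f* = g*
    (∀ {B B' : CABAO} (f g : CABAOHom B B')
       → (∀ b b' → jMor f b b' ⇔ jMor g b b')
       → ∀ x → CABAOHom.fun f x ≡ CABAOHom.fun g x)
    -- injective on objects
    × (∀ (B B' : CABAO) → jObj B ≡ jObj B' → B ≡ B')
mainTheorem19 = j-faithful , λ B B' jB≡jB' → jB≡jB'
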